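{- Let $G$ be a finite simple graph with vertex set $G_0$, let $D(G)$ be its double, and let $R$ be a lluf subquiver of $D(G)$ with $\dim(\operatorname{DE}(R))=\dim(\operatorname{SE}(G))-1$. The following are equivalent: (1) $\operatorname{DE}(R)$ is a facet of $\operatorname{SE}(G)$; (2) $c(R)=c(D(G))$ and there exists a rank function $\rho$ of $R$ such that $(\rho(v)-\rho(w)+1)(\rho(v')-\rho(w')+1)>0$ for all $(v,w),(v',w')\in D(G)_1\setminus R_1$; (3) $c(R)=c(D(G))$ and there exists $\rho\in\mathbb{R}^{G_0}$ such that for every $(v,w)\in D(G)_1$, \[\rho(v)-\rho(w)=\begin{cases}1 & ((v,w)\in R_1)\\ -1 & ((w,v)\in R_1)\\ 0 & (\text{otherwise}).\end{cases}\]
   Context: A quiver is a pair $Q=(Q_0,Q_1)$ with $Q_0$ finite and $Q_1\subset (Q_0\times Q_0)\setminus\{(v,v)\}$. The double $D(G)$ of a simple graph $G$ is the quiver with vertex set $G_0$ and edge set $\{(v,w),(w,v)\mid \{v,w\}\text{ an edge of }G\}$. A subquiver $R$ has $R_0\subset Q_0$, $R_1\subset Q_1$; lluf means $R_0=Q_0$. $\varepsilon_{(v,w)}=\kappa_{\{v\}}-\kappa_{\{w\}}\in\mathbb{R}^{Q_0}$ with $\kappa_{\{v\}}$ the indicator of $v$; $\operatorname{DE}(Q)=\operatorname{conv}\{\varepsilon_{(v,w)}\mid(v,w)\in Q_1\}$, and the symmetric edge polytope is $\operatorname{SE}(G)=\operatorname{DE}(D(G))$. $c(Q)=\#Q_0-\#\pi_0(Q)$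 with $\pi_0(Q)$ the set of connected components (connectivity via undirected walks). A rank function of $R$ is $\rho:R_0\to\mathbb{R}$ with $\rho(v)+1=\rho(w)$ for each $(v,w)\in R_1$.
   Formalization: The polytopes $\operatorname{DE}(R)$ and $\operatorname{SE}(G)$ are taken in ℚ^(G₀) instead of $\mathbb{R}^{G_0}$, as are the face normals and the functions ρ in conditions (2) and (3). -}

module Defs where

open import Data.Nat using (ℕ; zero; suc; _∸_)
open import Data.Fin using (Fin; zero; suc; _≟_)
open import Data.Bool using (Bool; true; false; if_then_else_)
open import Data.Rational using (ℚ; 0ℚ; 1ℚ; _+_; _*_; _-_; -_; _≤_; _<_)
open import Data.Product using (Σ; ∃; _×_; _,_)
open import Data.Sum using (_⊎_)
open import Relation.Binary.PropositionalEquality using (_≡_)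
open import Relation.Binary.Construct.Closure.ReflexiveTransitive using (Star)
open import Relation.Nullary using (¬_; does)

∑ : ∀ {m} → (Fin m → ℚ) → ℚ
∑ {zero} f = 0ℚ
∑ {suc m} f = f zero + ∑ (λ i → f (suc i))

∑₂ : ∀ {m} → (Fin m → Fin m → ℚ) → ℚ
∑₂ f = ∑ (λ v → ∑ (λ w → f v w))

-- points of ℚ^n (ℚ in place of ℝ) and sets of points
Point : ℕ → Set
Point n = Fin n → ℚ

PSet : ℕ → Set₁
PSet n = Point n → Set

_·_ : ∀ {n} → Point n → Point n → ℚ
a · x = ∑ (λ i → a i * x i)

record SimpleGraph (n : ℕ) : Set where
  field
    adj    : Fin n → Fin n → Bool
    sym    : ∀ v w → adj v w ≡ adj w v
    irrefl : ∀ v → adj v v ≡ false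

Quiver : ℕ → Set
Quiver n = Fin n → Fin n → Bool

-- the double D(G): arrows (v , w) and (w , v) for each edge {v , w}
double : ∀ {n} → SimpleGraph n → Quiver n
double G = SimpleGraph.adj G

-- lluf subquiver (same vertex set Fin n, arrow set contained in that of q)
IsLlufSubquiver : ∀ {n} → Quiver n → Quiver n → Set
IsLlufSubquiver r q = ∀ v w → r v w ≡ true → q v w ≡ true

κ : ∀ {n} → Fin n → Point n
κ v i = if does (v ≟ i) then 1ℚ else 0ℚ

ε : ∀ {n} → Fin n → Fin n → Point n
ε v w i = κ v i - κ w i

-- DE(Q) = conv { ε_(v,w) | (v,w) ∈ Q₁ }  (convex combinations of the finitely many generators)
DE : ∀ {n} → Quiver n → PSet n
DE {n} q x =
  Σ (Fin n → Fin n → ℚ) λ λ' →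
    (∀ v w → 0ℚ ≤ λ' v w) ×
    (∀ v w → q v w ≡ false → λ' v w ≡ 0ℚ) ×
    (∑₂ λ' ≡ 1ℚ) ×
    (∀ i → x i ≡ ∑₂ (λ v w → λ' v w * ε v w i))

SE : ∀ {n} → SimpleGraph n → PSet n
SE G = DE (double G)

AffinelyIndependent : ∀ {n k} → (Fin k → Point n) → Set
AffinelyIndependent {n} {k} p =
  (c : Fin k → ℚ) → ∑ c ≡ 0ℚ → (∀ i → ∑ (λ j → c j * p j i) ≡ 0ℚ) → ∀ j → c j ≡ 0ℚ

-- dim S = d  (d ≥ 0): S contains d+1 but not d+2 affinely independent points
AffDim : ∀ {n} → PSet n → ℕ → Set
AffDim {n} S d =
  (Σ (Fin (suc d) → Point n) λ p → (∀ j → S (p j)) × AffinelyIndependent p) ×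
  ((p : Fin (suc (suc d)) → Point n) → (∀ j → S (p j)) → ¬ AffinelyIndependent p)

IsFace : ∀ {n} → PSet n → PSet n → Set
IsFace {n} F P =
  Σ (Point n) λ a → Σ ℚ λ b →
    (∀ x → P x → (a · x) ≤ b) ×
    (∀ x → F x → P x × (a · x) ≡ b) ×
    (∀ x → P x → (a · x) ≡ b → F x)

IsFacet : ∀ {n} → PSet n → PSet n → Set
IsFacet F P = IsFace F P × ∃ λ d → AffDim F d × AffDim P (suc d)

Connected : ∀ {n} → Quiver n → Fin n → Fin n → Set
Connected q = Star (λ u v → (q u v ≡ true) ⊎ (q v u ≡ true))

-- #π₀(Q) = k : a surjective labelling whose fibres are exactly the components
NumComponents : ∀ {n} → Quiver n → ℕ → Set
NumComponents {n} q k =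
  Σ (Fin n → Fin k) λ f →
    (∀ u v → f u ≡ f v → Connected q u v) ×
    (∀ u v → Connected q u v → f u ≡ f v) ×
    (∀ j → ∃ λ v → f v ≡ j)

HasC : ∀ {n} → Quiver n → ℕ → Set
HasC {n} q c = ∃ λ k → NumComponents q k × c ≡ n ∸ k

IsRankFunction : ∀ {n} → Quiver n → (Fin n → ℚ) → Set
IsRankFunction r ρ = ∀ v w → r v w ≡ true → ρ v + 1ℚ ≡ ρ w

Cond1 : ∀ {n} → SimpleGraph n → Quiver n → Set
Cond1 G r = IsFacet (DE r) (SE G)

Cond2 : ∀ {n} → SimpleGraph n → Quiver n → Set
Cond2 {n} G r =
  (∃ λ c → HasC r c × HasC (double G) c) ×
  (Σ (Fin n → ℚ) λ ρ → IsRankFunction r ρ ×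
     (∀ v w v' w' →
        double G v w ≡ true → r v w ≡ false →
        double G v' w' ≡ true → r v' w' ≡ false →
        0ℚ < (ρ v - ρ w + 1ℚ) * (ρ v' - ρ w' + 1ℚ)))

Cond3 : ∀ {n} → SimpleGraph n → Quiver n → Set
Cond3 {n} G r =
  (∃ λ c → HasC r c × HasC (double G) c) ×
  (Σ (Fin n → ℚ) λ ρ →
     ∀ v w → double G v w ≡ true →
       (r v w ≡ true → ρ v - ρ w ≡ 1ℚ) ×
       (r w v ≡ true → ρ v - ρ w ≡ - 1ℚ) ×
       (r v w ≡ false → r w v ≡ false → ρ v - ρ w ≡ 0ℚ))

-- A functional a with a v - a w ≤ b on all arrows of D(G) is valid on SE(G), and its face is the
-- convex hull of the tight arrows. So DE(R) is a face cut out by (a , b) exactly when the tight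
-- arrows are those of R; rescaling by ρ = - a / b, this is the sign condition of (2), once b > 0.
-- The dimension gap gives b > 0 and puts both ends of every edge of G into one component of R:
-- otherwise the indicator of that component would exhibit too many affinely independent points
-- of SE(G). Conversely (3) directly provides the facet functional, and (2) implies (3) because
-- rank differences inside a component are integers, while the product condition confines them
-- to (-1, 1) on edges outside R.

module Submission where

open import Defs
open import Data.Bool using (true; false; if_then_else_)
import Data.Bool.Properties as Bool
open import Data.Empty using (⊥-elim)
open import Data.Fin using (Fin; zero; suc; _≟_; punchOut)
open import Data.Fin.Properties using (any?; suc-injective; punchOut-injective; injective⇒≤)
open import Data.List as List using (List; []; cartesianProduct; allFin)
open import Data.List.Membership.Propositional using (_∈_)
open import Data.List.Membership.Propositional.Properties using (∈-cartesianProduct⁺; ∈-allFin)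
open import Data.List.Relation.Unary.Any using (here; there)
open import Data.Nat as ℕ using (ℕ; zero; suc; _∸_)
import Data.Nat.Properties as ℕ
open import Data.Product
open import Data.Rational hiding (_≟_)
open import Data.Rational.Properties hiding (_≟_)
open import Data.Rational.Solver
open import Data.Sum using (_⊎_; inj₁; inj₂)
open import Data.Vec.Functional using (_∷_)
open import Function using (_∘_)
open import Function.Bundles using (_⇔_; mk⇔)
open import Relation.Binary.Construct.Closure.ReflexiveTransitive as Star using (Star; _◅_; _◅◅_)
open import Relation.Binary.Definitions using (tri<; tri≈; tri>)
open import Relation.Binary.PropositionalEquality
open import Relation.Binary.Structures using (IsDecEquivalence)
open import Relation.Nullary
open import Relation.Nullary.Decidable using (map′; _⊎-dec_; _×-dec_; dec-true; dec-false; toWitness)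
open +-*-Solver

0≤1 : 0ℚ ≤ 1ℚ
0≤1 = toWitness {a? = 0ℚ ≤? 1ℚ} _

≤⇒0≤- : ∀ {p q} → p ≤ q → 0ℚ ≤ q - p
≤⇒0≤- {p} {q} p≤q = subst (_≤ q - p) (+-inverseʳ p) (+-monoˡ-≤ (- p) p≤q)

<⇒0<- : ∀ {p q} → p < q → 0ℚ < q - p
<⇒0<- {p} {q} p<q = subst (_< q - p) (+-inverseʳ p) (+-monoˡ-< (- p) p<q)

0≤-⇒≤ : ∀ {p q} → 0ℚ ≤ q - p → p ≤ q
0≤-⇒≤ {p} {q} 0≤q-p = subst₂ _≤_ (+-identityˡ p) (solve 2 (λ x y → y :- x :+ x := y) refl p q)
  (+-monoˡ-≤ p 0≤q-p)

-≡0⇒≡ : ∀ {p q} → q - p ≡ 0ℚ → p ≡ q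
-≡0⇒≡ {p} {q} q-p≡0 = begin
  p               ≡⟨ solve 2 (λ x y → x := y :- (y :- x)) refl p q ⟩
  q - (q - p)     ≡⟨ cong (λ z → q - z) q-p≡0 ⟩
  q - 0ℚ          ≡⟨ +-identityʳ q ⟩
  q               ∎
  where open ≡-Reasoning

telescope : ∀ x y z → z - x ≡ (z - y) + (y - x)
telescope = solve 3 (λ x y z → z :- x := z :- y :+ (y :- x)) refl

+-nonNeg-≡0ˡ : ∀ {p q} → 0ℚ ≤ p → 0ℚ ≤ q → p + q ≡ 0ℚ → p ≡ 0ℚ
+-nonNeg-≡0ˡ {p} {q} p≥0 q≥0 p+q≡0 =
  ≤-antisym (subst₂ _≤_ (+-identityʳ p) p+q≡0 (+-monoʳ-≤ p q≥0)) p≥0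

+-zeroˡ-cancel : ∀ {p q} → p ≡ 0ℚ → p + q ≡ 0ℚ → q ≡ 0ℚ
+-zeroˡ-cancel {p} {q} p≡0 p+q≡0 = trans (sym (+-identityˡ q)) (trans (cong (_+ q) (sym p≡0)) p+q≡0)

*-nonNeg : ∀ {p q} → 0ℚ ≤ p → 0ℚ ≤ q → 0ℚ ≤ p * q
*-nonNeg {p} {q} p≥0 q≥0 =
  nonNegative⁻¹ (p * q) {{nonNeg*nonNeg⇒nonNeg p {{nonNegative p≥0}} q {{nonNegative q≥0}}}}

*-pos : ∀ {p q} → 0ℚ < p → 0ℚ < q → 0ℚ < p * q
*-pos {p} {q} p>0 q>0 = positive⁻¹ (p * q) {{pos*pos⇒pos p {{positive p>0}} q {{positive q>0}}}}

*≡0⇒≡0ˡ : ∀ {p q} → q ≢ 0ℚ → p * q ≡ 0ℚ → p ≡ 0ℚ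
*≡0⇒≡0ˡ {p} {q} q≢0 p*q≡0 = begin
  p                  ≡⟨ sym (*-identityʳ p) ⟩
  p * 1ℚ             ≡⟨ cong (p *_) (sym (*-inverseʳ q)) ⟩
  p * (q * 1/ q)     ≡⟨ sym (*-assoc p q (1/ q)) ⟩
  p * q * 1/ q       ≡⟨ cong (_* 1/ q) p*q≡0 ⟩
  0ℚ * 1/ q          ≡⟨ *-zeroˡ (1/ q) ⟩
  0ℚ                 ∎
  where
    open ≡-Reasoning
    instance
      q-nonZero : NonZero q
      q-nonZero = ≢-nonZero q≢0

∑-cong : ∀ {m} {f g : Fin m → ℚ} → (∀ i → f i ≡ g i) → ∑ f ≡ ∑ g
∑-cong {zero} f≡g = refl
∑-cong {suc m} f≡g = cong₂ _+_ (f≡g zero) (∑-cong (λ i → f≡g (suc i)))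

∑-0 : ∀ {m} {f : Fin m → ℚ} → (∀ i → f i ≡ 0ℚ) → ∑ f ≡ 0ℚ
∑-0 {zero} f≡0 = refl
∑-0 {suc m} f≡0 = trans (cong₂ _+_ (f≡0 zero) (∑-0 (λ i → f≡0 (suc i)))) (+-identityˡ 0ℚ)

∑-+ : ∀ {m} (f g : Fin m → ℚ) → ∑ (λ i → f i + g i) ≡ ∑ f + ∑ g
∑-+ {zero} f g = refl
∑-+ {suc m} f g = trans (cong (f zero + g zero +_) (∑-+ (λ i → f (suc i)) (λ i → g (suc i))))
  (solve 4 (λ a b c d → a :+ b :+ (c :+ d) := a :+ c :+ (b :+ d)) refl
     (f zero) (g zero) (∑ (λ i → f (suc i))) (∑ (λ i → g (suc i))))

∑-*ˡ : ∀ {m} (c : ℚ) (f : Fin m → ℚ) → ∑ (λ i → c * f i) ≡ c * ∑ f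
∑-*ˡ {zero} c f = sym (*-zeroʳ c)
∑-*ˡ {suc m} c f = trans (cong (c * f zero +_) (∑-*ˡ c (λ i → f (suc i))))
  (sym (*-distribˡ-+ c _ _))

∑-neg : ∀ {m} (f : Fin m → ℚ) → ∑ (λ i → - f i) ≡ - ∑ f
∑-neg {zero} f = refl
∑-neg {suc m} f = trans (cong (- f zero +_) (∑-neg (λ i → f (suc i))))
  (sym (neg-distrib-+ (f zero) (∑ (λ i → f (suc i)))))

∑-- : ∀ {m} (f g : Fin m → ℚ) → ∑ (λ i → f i - g i) ≡ ∑ f - ∑ g
∑-- f g = trans (∑-+ f (λ i → - g i)) (cong (∑ f +_) (∑-neg g))

∑-swap : ∀ {m k} (f : Fin m → Fin k → ℚ) →
  ∑ (λ i → ∑ (λ j → f i j)) ≡ ∑ (λ j → ∑ (λ i → f i j))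
∑-swap {zero} {k} f = sym (∑-0 {k} (λ _ → refl))
∑-swap {suc m} f = trans (cong (∑ (f zero) +_) (∑-swap (λ i → f (suc i))))
  (sym (∑-+ (f zero) (λ j → ∑ (λ i → f (suc i) j))))

∑-mono-≤ : ∀ {m} {f g : Fin m → ℚ} → (∀ i → f i ≤ g i) → ∑ f ≤ ∑ g
∑-mono-≤ {zero} f≤g = ≤-refl
∑-mono-≤ {suc m} f≤g = +-mono-≤ (f≤g zero) (∑-mono-≤ (λ i → f≤g (suc i)))

∑-nonNeg : ∀ {m} {f : Fin m → ℚ} → (∀ i → 0ℚ ≤ f i) → 0ℚ ≤ ∑ f
∑-nonNeg {m} {f} f≥0 = subst (_≤ ∑ f) (∑-0 {m} (λ _ → refl)) (∑-mono-≤ f≥0)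

∑-nonNeg-≡0 : ∀ {m} {f : Fin m → ℚ} → (∀ i → 0ℚ ≤ f i) → ∑ f ≡ 0ℚ → ∀ i → f i ≡ 0ℚ
∑-nonNeg-≡0 {suc m} f≥0 ∑≡0 zero = +-nonNeg-≡0ˡ (f≥0 zero) (∑-nonNeg (λ i → f≥0 (suc i))) ∑≡0
∑-nonNeg-≡0 {suc m} {f} f≥0 ∑≡0 (suc i) =
  ∑-nonNeg-≡0 (λ j → f≥0 (suc j))
    (+-nonNeg-≡0ˡ (∑-nonNeg (λ j → f≥0 (suc j))) (f≥0 zero)
      (trans (+-comm _ (f zero)) ∑≡0)) i

∑₂-cong : ∀ {m} {f g : Fin m → Fin m → ℚ} → (∀ v w → f v w ≡ g v w) → ∑₂ f ≡ ∑₂ g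
∑₂-cong f≡g = ∑-cong (λ v → ∑-cong (f≡g v))

∑₂-0 : ∀ {m} {f : Fin m → Fin m → ℚ} → (∀ v w → f v w ≡ 0ℚ) → ∑₂ f ≡ 0ℚ
∑₂-0 f≡0 = ∑-0 (λ v → ∑-0 (f≡0 v))

∑₂-+ : ∀ {m} (f g : Fin m → Fin m → ℚ) → ∑₂ (λ v w → f v w + g v w) ≡ ∑₂ f + ∑₂ g
∑₂-+ f g = trans (∑-cong (λ v → ∑-+ (f v) (g v))) (∑-+ (λ v → ∑ (f v)) (λ v → ∑ (g v)))

∑₂-*ˡ : ∀ {m} (c : ℚ) (f : Fin m → Fin m → ℚ) → ∑₂ (λ v w → c * f v w) ≡ c * ∑₂ f
∑₂-*ˡ c f = trans (∑-cong (λ v → ∑-*ˡ c (f v))) (∑-*ˡ c (λ v → ∑ (f v)))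

∑₂-- : ∀ {m} (f g : Fin m → Fin m → ℚ) → ∑₂ (λ v w → f v w - g v w) ≡ ∑₂ f - ∑₂ g
∑₂-- f g = trans (∑-cong (λ v → ∑-- (f v) (g v))) (∑-- (λ v → ∑ (f v)) (λ v → ∑ (g v)))

∑₂-nonNeg : ∀ {m} {f : Fin m → Fin m → ℚ} → (∀ v w → 0ℚ ≤ f v w) → 0ℚ ≤ ∑₂ f
∑₂-nonNeg f≥0 = ∑-nonNeg (λ v → ∑-nonNeg (f≥0 v))

∑₂-nonNeg-≡0 : ∀ {m} {f : Fin m → Fin m → ℚ} → (∀ v w → 0ℚ ≤ f v w) → ∑₂ f ≡ 0ℚ →
  ∀ v w → f v w ≡ 0ℚ
∑₂-nonNeg-≡0 f≥0 ∑≡0 v =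
  ∑-nonNeg-≡0 (f≥0 v) (∑-nonNeg-≡0 (λ v → ∑-nonNeg (f≥0 v)) ∑≡0 v)

-- Linear functionals on DE(Q)

κ-diag : ∀ {n} (v : Fin n) → κ v v ≡ 1ℚ
κ-diag v = cong (λ b → if b then 1ℚ else 0ℚ) (dec-true (v ≟ v) refl)

κ-off : ∀ {n} {v x : Fin n} → v ≢ x → κ v x ≡ 0ℚ
κ-off {v = v} {x} v≢x = cong (λ b → if b then 1ℚ else 0ℚ) (dec-false (v ≟ x) v≢x)

0≤κ : ∀ {n} (v x : Fin n) → 0ℚ ≤ κ v x
0≤κ v x with v ≟ x
... | yes _ = 0≤1
... | no _ = ≤-refl

κ≤1 : ∀ {n} (v x : Fin n) → κ v x ≤ 1ℚ
κ≤1 v x with v ≟ x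
... | yes _ = ≤-refl
... | no _ = 0≤1

∑-κ : ∀ {m} (v : Fin m) (f : Fin m → ℚ) → ∑ (λ i → κ v i * f i) ≡ f v
∑-κ {suc m} zero f =
  trans (cong₂ _+_ (*-identityˡ (f zero)) (∑-0 (λ i → *-zeroˡ (f (suc i))))) (+-identityʳ (f zero))
∑-κ {suc m} (suc v) f =
  trans (cong₂ _+_ (*-zeroˡ (f zero)) (∑-κ v (λ i → f (suc i)))) (+-identityˡ (f (suc v)))

ε≤1 : ∀ {n} (v w x : Fin n) → ε v w x ≤ 1ℚ
ε≤1 v w x = subst₂ _≤_ refl (+-identityʳ 1ℚ) (+-mono-≤ (κ≤1 v x) (neg-antimono-≤ (0≤κ w x)))

ε≤0 : ∀ {n} {v x : Fin n} (w : Fin n) → v ≢ x → ε v w x ≤ 0ℚ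
ε≤0 {v = v} {x} w v≢x = subst₂ _≤_ (cong (_- κ w x) (sym (κ-off v≢x))) (+-identityˡ 0ℚ)
  (+-monoʳ-≤ 0ℚ (neg-antimono-≤ (0≤κ w x)))

ε-neg : ∀ {n} (v w x : Fin n) → - ε v w x ≡ ε w v x
ε-neg v w x = solve 2 (λ p q → :- (p :- q) := q :- p) refl (κ v x) (κ w x)

·-ε : ∀ {n} (a : Point n) (v w : Fin n) → a · ε v w ≡ a v - a w
·-ε a v w = begin
  ∑ (λ i → a i * (κ v i - κ w i))        ≡⟨ ∑-cong (λ i → solve 3 (λ x p q → x :* (p :- q) := p :* x :- q :* x) refl (a i) (κ v i) (κ w i)) ⟩
  ∑ (λ i → κ v i * a i - κ w i * a i)    ≡⟨ ∑-- (λ i → κ v i * a i) (λ i → κ w i * a i) ⟩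
  ∑ (λ i → κ v i * a i) - ∑ (λ i → κ w i * a i) ≡⟨ cong₂ _-_ (∑-κ v a) (∑-κ w a) ⟩
  a v - a w                              ∎
  where open ≡-Reasoning

·-∑ : ∀ {n k} (a : Point n) (p : Fin k → Point n) → a · (λ i → ∑ (λ j → p j i)) ≡ ∑ (λ j → a · p j)
·-∑ a p = trans (∑-cong (λ i → sym (∑-*ˡ (a i) (λ j → p j i)))) (∑-swap (λ i j → a i * p j i))

·-* : ∀ {n} (a : Point n) (c : ℚ) (p : Point n) → a · (λ i → c * p i) ≡ c * (a · p)
·-* a c p = trans (∑-cong (λ i → solve 3 (λ x y z → x :* (y :* z) := y :* (x :* z)) refl (a i) c (p i)))
  (∑-*ˡ c (λ i → a i * p i))

·-zeroʳ : ∀ {n} (a : Point n) → a · (λ _ → 0ℚ) ≡ 0ℚ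
·-zeroʳ a = ∑-0 (λ i → *-zeroʳ (a i))

·-combination : ∀ {n k} (a : Point n) (c : Fin k → ℚ) (p : Fin k → Point n) →
  a · (λ i → ∑ (λ j → c j * p j i)) ≡ ∑ (λ j → c j * (a · p j))
·-combination a c p = trans (·-∑ a (λ j i → c j * p j i)) (∑-cong (λ j → ·-* a (c j) (p j)))

·-weights : ∀ {n} (a : Point n) (l : Fin n → Fin n → ℚ) {x : Point n} →
  (∀ i → x i ≡ ∑₂ (λ v w → l v w * ε v w i)) → a · x ≡ ∑₂ (λ v w → l v w * (a v - a w))
·-weights a l {x} x≡ = begin
  a · x                                              ≡⟨ ∑-cong (λ i → cong (a i *_) (x≡ i)) ⟩
  a · (λ i → ∑ (λ v → ∑ (λ w → l v w * ε v w i)))    ≡⟨ ·-∑ a (λ v i → ∑ (λ w → l v w * ε v w i)) ⟩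
  ∑ (λ v → a · (λ i → ∑ (λ w → l v w * ε v w i)))    ≡⟨ ∑-cong (λ v → ·-combination a (l v) (ε v)) ⟩
  ∑₂ (λ v w → l v w * (a · ε v w))                   ≡⟨ ∑₂-cong (λ v w → cong (l v w *_) (·-ε a v w)) ⟩
  ∑₂ (λ v w → l v w * (a v - a w))                   ∎
  where open ≡-Reasoning

weight : ∀ {n} {q : Quiver n} {x : Point n} → DE q x → Fin n → Fin n → ℚ
weight = proj₁

DE-gap : ∀ {n} {q : Quiver n} {x : Point n} (a : Point n) (b : ℚ) (x∈ : DE q x) →
  b - a · x ≡ ∑₂ (λ v w → weight x∈ v w * (b - (a v - a w)))
DE-gap {x = x} a b (l , _ , _ , ∑l≡1 , x≡) = sym (begin
  ∑₂ (λ v w → l v w * (b - (a v - a w)))          ≡⟨ ∑₂-cong (λ v w → *-distribˡ-+ (l v w) b (- (a v - a w))) ⟩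
  ∑₂ (λ v w → l v w * b + l v w * - (a v - a w))  ≡⟨ ∑₂-cong (λ v w → cong₂ _+_ (*-comm (l v w) b) (sym (neg-distribʳ-* (l v w) _))) ⟩
  ∑₂ (λ v w → b * l v w - l v w * (a v - a w))    ≡⟨ ∑₂-- (λ v w → b * l v w) (λ v w → l v w * (a v - a w)) ⟩
  ∑₂ (λ v w → b * l v w) - ∑₂ (λ v w → l v w * (a v - a w))
                                                  ≡⟨ cong₂ _-_ (trans (∑₂-*ˡ b l) (cong (b *_) ∑l≡1)) (sym (·-weights a l x≡)) ⟩
  b * 1ℚ - a · x                                  ≡⟨ cong (_- a · x) (*-identityʳ b) ⟩
  b - a · x                                       ∎)
  where open ≡-Reasoning

slack-nonNeg : ∀ {n} {q : Quiver n} {x : Point n} (a : Point n) (b : ℚ) →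
  (∀ v w → q v w ≡ true → a v - a w ≤ b) → (x∈ : DE q x) →
  ∀ v w → 0ℚ ≤ weight x∈ v w * (b - (a v - a w))
slack-nonNeg {q = q} a b bound (l , l≥0 , l-supp , _) v w with q v w in e
... | true = *-nonNeg (l≥0 v w) (≤⇒0≤- (bound v w e))
... | false = ≤-reflexive (sym (trans (cong (_* _) (l-supp v w e)) (*-zeroˡ (b - (a v - a w)))))

DE-bound : ∀ {n} {q : Quiver n} {x : Point n} (a : Point n) (b : ℚ) →
  (∀ v w → q v w ≡ true → a v - a w ≤ b) → DE q x → a · x ≤ b
DE-bound a b bound x∈ =
  0≤-⇒≤ (subst (0ℚ ≤_) (sym (DE-gap a b x∈)) (∑₂-nonNeg (slack-nonNeg a b bound x∈)))

DE-level : ∀ {n} {q : Quiver n} {x : Point n} (a : Point n) (b : ℚ) →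
  (∀ v w → q v w ≡ true → a v - a w ≡ b) → DE q x → a · x ≡ b
DE-level {q = q} a b level x∈@(l , _ , l-supp , _) =
  -≡0⇒≡ (trans (DE-gap a b x∈) (∑₂-0 slack≡0))
  where
    slack≡0 : ∀ v w → l v w * (b - (a v - a w)) ≡ 0ℚ
    slack≡0 v w with q v w in e
    ... | true = trans (cong (λ d → l v w * (b - d)) (level v w e))
                   (trans (cong (l v w *_) (+-inverseʳ b)) (*-zeroʳ (l v w)))
    ... | false = trans (cong (_* _) (l-supp v w e)) (*-zeroˡ (b - (a v - a w)))

DE-tight : ∀ {n} {q r : Quiver n} {x : Point n} (a : Point n) (b : ℚ) →
  (∀ v w → q v w ≡ true → a v - a w ≤ b) →
  (∀ v w → q v w ≡ true → a v - a w ≡ b → r v w ≡ true) →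
  DE q x → a · x ≡ b → DE r x
DE-tight {q = q} {r} a b bound tight⇒r x∈@(l , l≥0 , l-supp , ∑l≡1 , x≡) a·x≡b =
  l , l≥0 , r-supp , ∑l≡1 , x≡
  where
    slack≡0 : ∀ v w → l v w * (b - (a v - a w)) ≡ 0ℚ
    slack≡0 = ∑₂-nonNeg-≡0 (slack-nonNeg a b bound x∈)
      (trans (sym (DE-gap a b x∈)) (trans (cong (λ z → b - z) a·x≡b) (+-inverseʳ b)))
    r-supp : ∀ v w → r v w ≡ false → l v w ≡ 0ℚ
    r-supp v w r≢ with q v w in e
    ... | false = l-supp v w e
    ... | true with <-cmp (a v - a w) b
    ...   | tri< d<b _ _ = *≡0⇒≡0ˡ (<⇒≢ (<⇒0<- d<b) ∘ sym) (slack≡0 v w)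
    ...   | tri≈ _ d≡b _ = contradiction (trans (sym (tight⇒r v w e d≡b)) r≢) λ ()
    ...   | tri> _ _ d>b = ⊥-elim (<-irrefl refl (<-≤-trans d>b (bound v w e)))

DE-resp : ∀ {n} {q : Quiver n} {x y : Point n} → (∀ i → x i ≡ y i) → DE q x → DE q y
DE-resp x≡y (l , l≥0 , l-supp , ∑l≡1 , x≡) = l , l≥0 , l-supp , ∑l≡1 , (λ i → trans (sym (x≡y i)) (x≡ i))

DE-mono : ∀ {n} {q q′ : Quiver n} {x : Point n} → (∀ v w → q v w ≡ true → q′ v w ≡ true) → DE q x → DE q′ x
DE-mono {q = q} {q′} q⊆q′ (l , l≥0 , l-supp , ∑l≡1 , x≡) = l , l≥0 , q′-supp , ∑l≡1 , x≡
  where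
    q′-supp : ∀ v w → q′ v w ≡ false → l v w ≡ 0ℚ
    q′-supp v w q′≢ with q v w in e
    ... | false = l-supp v w e
    ... | true = contradiction (trans (sym (q⊆q′ v w e)) q′≢) λ ()

∑₂-point-mass : ∀ {n} (v w : Fin n) (f : Fin n → Fin n → ℚ) →
  ∑₂ (λ x y → κ v x * κ w y * f x y) ≡ f v w
∑₂-point-mass v w f = begin
  ∑ (λ x → ∑ (λ y → κ v x * κ w y * f x y))      ≡⟨ ∑-cong (λ x → ∑-cong (λ y → *-assoc (κ v x) (κ w y) (f x y))) ⟩
  ∑ (λ x → ∑ (λ y → κ v x * (κ w y * f x y)))    ≡⟨ ∑-cong (λ x → ∑-*ˡ (κ v x) (λ y → κ w y * f x y)) ⟩
  ∑ (λ x → κ v x * ∑ (λ y → κ w y * f x y))      ≡⟨ ∑-cong (λ x → cong (κ v x *_) (∑-κ w (f x))) ⟩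
  ∑ (λ x → κ v x * f x w)                        ≡⟨ ∑-κ v (λ x → f x w) ⟩
  f v w                                          ∎
  where open ≡-Reasoning

ε∈DE : ∀ {n} {q : Quiver n} {v w : Fin n} → q v w ≡ true → DE q (ε v w)
ε∈DE {q = q} {v} {w} qvw = δ , δ≥0 , δ-supp , ∑δ≡1 , λ i → sym (∑₂-point-mass v w (λ x y → ε x y i))
  where
    δ : Fin _ → Fin _ → ℚ
    δ x y = κ v x * κ w y
    δ≥0 : ∀ x y → 0ℚ ≤ δ x y
    δ≥0 x y = *-nonNeg (0≤κ v x) (0≤κ w y)
    δ-supp : ∀ x y → q x y ≡ false → δ x y ≡ 0ℚ
    δ-supp x y qxy≢ = by-cases (v ≟ x) (w ≟ y)
      where
        by-cases : Dec (v ≡ x) → Dec (w ≡ y) → δ x y ≡ 0ℚ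
        by-cases (yes refl) (yes refl) = contradiction (trans (sym qvw) qxy≢) λ ()
        by-cases (no v≢x) _ = trans (cong (_* κ w y) (κ-off v≢x)) (*-zeroˡ (κ w y))
        by-cases _ (no w≢y) = trans (cong (κ v x *_) (κ-off w≢y)) (*-zeroʳ (κ v x))
    ∑δ≡1 : ∑₂ δ ≡ 1ℚ
    ∑δ≡1 = trans (∑₂-cong (λ x y → sym (*-identityʳ (δ x y)))) (∑₂-point-mass v w (λ _ _ → 1ℚ))

DE-midpoint : ∀ {n} {q : Quiver n} {x y : Point n} → DE q x → DE q y → DE q (λ i → ½ * (x i + y i))
DE-midpoint {q = q} {x} {y} (l , l≥0 , l-supp , ∑l≡1 , x≡) (m , m≥0 , m-supp , ∑m≡1 , y≡) =
  avg , avg≥0 , avg-supp , ∑avg≡1 , avg-rep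
  where
    avg : Fin _ → Fin _ → ℚ
    avg v w = ½ * (l v w + m v w)
    avg≥0 : ∀ v w → 0ℚ ≤ avg v w
    avg≥0 v w = *-nonNeg (toWitness {a? = 0ℚ ≤? ½} _) (+-mono-≤ (l≥0 v w) (m≥0 v w))
    avg-supp : ∀ v w → q v w ≡ false → avg v w ≡ 0ℚ
    avg-supp v w e = trans (cong₂ (λ p q → ½ * (p + q)) (l-supp v w e) (m-supp v w e)) refl
    ∑-avg : (f : Fin _ → Fin _ → ℚ) →
      ∑₂ (λ v w → avg v w * f v w) ≡ ½ * (∑₂ (λ v w → l v w * f v w) + ∑₂ (λ v w → m v w * f v w))
    ∑-avg f = begin
      ∑₂ (λ v w → avg v w * f v w)
        ≡⟨ ∑₂-cong (λ v w → solve 4 (λ h p q z → h :* (p :+ q) :* z := h :* (p :* z :+ q :* z)) refl ½ (l v w) (m v w) (f v w)) ⟩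
      ∑₂ (λ v w → ½ * (l v w * f v w + m v w * f v w))
        ≡⟨ ∑₂-*ˡ ½ (λ v w → l v w * f v w + m v w * f v w) ⟩
      ½ * ∑₂ (λ v w → l v w * f v w + m v w * f v w)
        ≡⟨ cong (½ *_) (∑₂-+ (λ v w → l v w * f v w) (λ v w → m v w * f v w)) ⟩
      ½ * (∑₂ (λ v w → l v w * f v w) + ∑₂ (λ v w → m v w * f v w)) ∎
      where open ≡-Reasoning
    ∑avg≡1 : ∑₂ avg ≡ 1ℚ
    ∑avg≡1 = trans (∑₂-cong (λ v w → sym (*-identityʳ (avg v w))))
      (trans (∑-avg (λ _ _ → 1ℚ))
        (trans (cong₂ (λ p q → ½ * (p + q)) (trans (∑₂-cong (λ v w → *-identityʳ (l v w))) ∑l≡1)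
                                             (trans (∑₂-cong (λ v w → *-identityʳ (m v w))) ∑m≡1)) refl))
    avg-rep : ∀ i → ½ * (x i + y i) ≡ ∑₂ (λ v w → avg v w * ε v w i)
    avg-rep i = trans (cong₂ (λ p q → ½ * (p + q)) (x≡ i) (y≡ i)) (sym (∑-avg (λ v w → ε v w i)))

origin∈DE : ∀ {n} {q : Quiver n} {v w : Fin n} → q v w ≡ true → q w v ≡ true → DE q (λ _ → 0ℚ)
origin∈DE {v = v} {w} qvw qwv = DE-resp antipodal (DE-midpoint (ε∈DE qvw) (ε∈DE qwv))
  where
    antipodal : ∀ i → ½ * (ε v w i + ε w v i) ≡ 0ℚ
    antipodal i = solve 3 (λ h p q → h :* (p :- q :+ (q :- p)) := con 0ℚ) refl ½ (κ v i) (κ w i)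

ε-slope≤1 : ∀ {n} (v w : Fin n) {x y : Fin n} → v ≢ x ⊎ w ≢ y → ε v w x - ε v w y ≤ 1ℚ
ε-slope≤1 v w {x} {y} off = subst (_≤ 1ℚ) (cong (ε v w x +_) (sym (ε-neg v w y))) (bound off)
  where
    bound : v ≢ x ⊎ w ≢ y → ε v w x + ε w v y ≤ 1ℚ
    bound (inj₁ v≢x) = subst (ε v w x + ε w v y ≤_) (+-identityˡ 1ℚ) (+-mono-≤ (ε≤0 w v≢x) (ε≤1 w v y))
    bound (inj₂ w≢y) = subst (ε v w x + ε w v y ≤_) (+-identityʳ 1ℚ) (+-mono-≤ (ε≤1 v w x) (ε≤0 v w≢y))

-- The functional ε v w takes the value 2 at ε v w but at most 1 at every other generator.
ε∉DE : ∀ {n} {r : Quiver n} {v w : Fin n} → v ≢ w → r v w ≡ false → ¬ DE r (ε v w)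
ε∉DE {r = r} {v} {w} v≢w rvw≢ ε∈ =
  <-irrefl refl (<-≤-trans 1<2 (subst (_≤ 1ℚ) ε·ε≡2 (DE-bound (ε v w) 1ℚ slope≤1 ε∈)))
  where
    slope≤1 : ∀ x y → r x y ≡ true → ε v w x - ε v w y ≤ 1ℚ
    slope≤1 x y rxy = by-cases (v ≟ x) (w ≟ y)
      where
        by-cases : Dec (v ≡ x) → Dec (w ≡ y) → ε v w x - ε v w y ≤ 1ℚ
        by-cases (yes refl) (yes refl) = contradiction (trans (sym rxy) rvw≢) λ ()
        by-cases (no v≢x) _ = ε-slope≤1 v w (inj₁ v≢x)
        by-cases _ (no w≢y) = ε-slope≤1 v w (inj₂ w≢y)
    ε·ε≡2 : ε v w · ε v w ≡ 1ℚ + 1ℚ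
    ε·ε≡2 = trans (·-ε (ε v w) v w)
      (cong₂ _-_ (cong₂ _-_ (κ-diag v) (κ-off (v≢w ∘ sym))) (cong₂ _-_ (κ-off v≢w) (κ-diag w)))
    1<2 : 1ℚ < 1ℚ + 1ℚ
    1<2 = toWitness {a? = 1ℚ <? 1ℚ + 1ℚ} _

-- Affine independence

·-vanishing-combination : ∀ {n k} {c : Fin k → ℚ} {p : Fin k → Point n} →
  (∀ i → ∑ (λ j → c j * p j i) ≡ 0ℚ) → (h : Point n) → ∑ (λ j → c j * (h · p j)) ≡ 0ℚ
·-vanishing-combination {c = c} {p} comb≡0 h =
  trans (sym (·-combination h c p)) (∑-0 (λ i → trans (cong (h i *_) (comb≡0 i)) (*-zeroʳ (h i))))

AffinelyIndependent-tail : ∀ {n k} {x : Point n} {p : Fin k → Point n} → AffinelyIndependent p →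
  (c : Fin (suc k) → ℚ) → c zero ≡ 0ℚ → ∑ c ≡ 0ℚ → (∀ i → ∑ (λ j → c j * (x ∷ p) j i) ≡ 0ℚ) →
  ∀ j → c j ≡ 0ℚ
AffinelyIndependent-tail p-indep c c₀≡0 ∑c≡0 comb≡0 zero = c₀≡0
AffinelyIndependent-tail {x = x} p-indep c c₀≡0 ∑c≡0 comb≡0 (suc j) =
  p-indep (c ∘ suc) (+-zeroˡ-cancel c₀≡0 ∑c≡0)
    (λ i → +-zeroˡ-cancel (trans (cong (_* x i) c₀≡0) (*-zeroˡ (x i))) (comb≡0 i)) j

AffinelyIndependent-∷ : ∀ {n k} {x : Point n} {p : Fin k → Point n} (h : Point n) →
  (∀ j → h · p j ≡ 0ℚ) → h · x ≢ 0ℚ → AffinelyIndependent p → AffinelyIndependent (x ∷ p)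
AffinelyIndependent-∷ {x = x} {p} h h·p≡0 h·x≢0 p-indep c ∑c≡0 comb≡0 =
  AffinelyIndependent-tail p-indep c c₀≡0 ∑c≡0 comb≡0
  where
    c₀≡0 : c zero ≡ 0ℚ
    c₀≡0 = *≡0⇒≡0ˡ h·x≢0 (begin
      c zero * (h · x)                                   ≡⟨ sym (+-identityʳ _) ⟩
      c zero * (h · x) + 0ℚ                              ≡⟨ cong (c zero * (h · x) +_) (sym (∑-0 tail≡0)) ⟩
      c zero * (h · x) + ∑ (λ j → c (suc j) * (h · p j)) ≡⟨ ·-vanishing-combination {c = c} {x ∷ p} comb≡0 h ⟩
      0ℚ                                                 ∎)
      where
        open ≡-Reasoning
        tail≡0 : ∀ j → c (suc j) * (h · p j) ≡ 0ℚ
        tail≡0 j = trans (cong (c (suc j) *_) (h·p≡0 j)) (*-zeroʳ (c (suc j)))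

AffinelyIndependent-origin∷ : ∀ {n k} {p : Fin k → Point n} (a : Point n) (b : ℚ) →
  (∀ j → a · p j ≡ b) → b ≢ 0ℚ → AffinelyIndependent p → AffinelyIndependent ((λ _ → 0ℚ) ∷ p)
AffinelyIndependent-origin∷ {p = p} a b a·p≡b b≢0 p-indep c ∑c≡0 comb≡0 =
  AffinelyIndependent-tail p-indep c c₀≡0 ∑c≡0 comb≡0
  where
    ∑c′≡0 : ∑ (c ∘ suc) ≡ 0ℚ
    ∑c′≡0 = *≡0⇒≡0ˡ b≢0 (begin
      ∑ (c ∘ suc) * b                             ≡⟨ *-comm (∑ (c ∘ suc)) b ⟩
      b * ∑ (c ∘ suc)                             ≡⟨ sym (∑-*ˡ b (c ∘ suc)) ⟩
      ∑ (λ j → b * c (suc j))                     ≡⟨ ∑-cong (λ j → trans (*-comm b (c (suc j))) (cong (c (suc j) *_) (sym (a·p≡b j)))) ⟩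
      ∑ (λ j → c (suc j) * (a · p j))             ≡⟨ +-zeroˡ-cancel head≡0 (·-vanishing-combination {c = c} {(λ _ → 0ℚ) ∷ p} comb≡0 a) ⟩
      0ℚ                                          ∎)
      where
        open ≡-Reasoning
        head≡0 : c zero * (a · (λ _ → 0ℚ)) ≡ 0ℚ
        head≡0 = trans (cong (c zero *_) (·-zeroʳ a)) (*-zeroʳ (c zero))
    c₀≡0 : c zero ≡ 0ℚ
    c₀≡0 = trans (sym (+-identityʳ (c zero))) (trans (cong (c zero +_) (sym ∑c′≡0)) ∑c≡0)

AffDim-⊆ : ∀ {n} {S T : PSet n} {d} → (∀ x → T x → S x) → AffDim S d → ¬ AffDim T (suc d)
AffDim-⊆ T⊆S (_ , S-small) ((p , p∈T , p-indep) , _) = S-small p (λ j → T⊆S (p j) (p∈T j)) p-indep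

-- Reachability and connected components

module _ {n} {E : Fin n → Fin n → Set} (E? : ∀ u v → Dec (E u v)) where

  private
    Restricted : List (Fin n × Fin n) → Fin n → Fin n → Set
    Restricted L u v = (u , v) ∈ L × E u v

    widen : ∀ {e L u v} → Restricted L u v → Restricted (e List.∷ L) u v
    widen (m , t) = there m , t

    star-restricted? : ∀ L u v → Dec (Star (Restricted L) u v)
    star-restricted? [] u v = map′ (λ { refl → Star.ε }) (λ { Star.ε → refl ; ((() , _) ◅ _) }) (u ≟ v)
    star-restricted? ((a , b) List.∷ L) u v with E? a b
    ... | no ¬Eab = map′ (Star.map widen) (Star.map narrow) (star-restricted? L u v)
      where
        narrow : ∀ {x y} → Restricted ((a , b) List.∷ L) x y → Restricted L x y
        narrow (here refl , Eab) = ⊥-elim (¬Eab Eab)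
        narrow (there m , t) = m , t
    -- A walk using the newly allowed edge (a , b) can be cut down to one using it only once.
    ... | yes Eab = map′ through-ab split
          (star-restricted? L u v ⊎-dec (star-restricted? L u a ×-dec star-restricted? L b v))
      where
        Old : Fin n → Fin n → Set
        Old = Star (Restricted L)
        through-ab : ∀ {x y} → Old x y ⊎ (Old x a × Old b y) → Star (Restricted ((a , b) List.∷ L)) x y
        through-ab (inj₁ p) = Star.map widen p
        through-ab (inj₂ (p , q)) = Star.map widen p ◅◅ ((here refl , Eab) ◅ Star.map widen q)
        split : ∀ {x y} → Star (Restricted ((a , b) List.∷ L)) x y → Old x y ⊎ (Old x a × Old b y)
        split Star.ε = inj₁ Star.ε
        split ((here refl , _) ◅ p) with split p
        ... | inj₁ q = inj₂ (Star.ε , q)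
        ... | inj₂ (_ , q) = inj₂ (Star.ε , q)
        split ((there m , t) ◅ p) with split p
        ... | inj₁ q = inj₁ ((m , t) ◅ q)
        ... | inj₂ (q₁ , q₂) = inj₂ ((m , t) ◅ q₁ , q₂)

  star? : ∀ u v → Dec (Star E u v)
  star? u v = map′ (Star.map proj₂) (Star.map everywhere) (star-restricted? allPairs u v)
    where
      allPairs : List (Fin n × Fin n)
      allPairs = cartesianProduct (allFin n) (allFin n)
      everywhere : ∀ {x y} → E x y → Restricted allPairs x y
      everywhere {x} {y} t = ∈-cartesianProduct⁺ (∈-allFin x) (∈-allFin y) , t

Labelling : ∀ {n} → (Fin n → Fin n → Set) → ℕ → Set
Labelling {n} R k =
  Σ (Fin n → Fin k) λ f →
    (∀ u v → f u ≡ f v → R u v) × (∀ u v → R u v → f u ≡ f v) × (∀ j → ∃ λ v → f v ≡ j)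

IsDecEquivalence-suc : ∀ {n} {R : Fin (suc n) → Fin (suc n) → Set} →
  IsDecEquivalence R → IsDecEquivalence (λ i j → R (suc i) (suc j))
IsDecEquivalence-suc R-equiv = record
  { isEquivalence = record { refl = R.refl ; sym = R.sym ; trans = R.trans }
  ; _≟_ = λ i j → suc i R.≟ suc j }
  where module R = IsDecEquivalence R-equiv

labelling : ∀ {n} {R : Fin n → Fin n → Set} → IsDecEquivalence R → ∃ (Labelling R)
labelling {zero} _ = 0 , (λ ()) , (λ ()) , (λ ()) , (λ ())
labelling {suc n} {R} R-equiv with labelling (IsDecEquivalence-suc R-equiv) | any? (λ j → R? zero (suc j))
  where open IsDecEquivalence R-equiv renaming (_≟_ to R?)
... | k , f , f-sound , f-complete , f-onto | yes (j₀ , R0j₀) = k , f′ , sound , complete , f-onto′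
  where
    module R = IsDecEquivalence R-equiv
    f′ : Fin (suc n) → Fin k
    f′ zero = f j₀
    f′ (suc i) = f i
    sound : ∀ u v → f′ u ≡ f′ v → R u v
    sound zero zero _ = R.refl
    sound zero (suc i) e = R.trans R0j₀ (f-sound j₀ i e)
    sound (suc i) zero e = R.sym (R.trans R0j₀ (f-sound j₀ i (sym e)))
    sound (suc i) (suc j) e = f-sound i j e
    complete : ∀ u v → R u v → f′ u ≡ f′ v
    complete zero zero _ = refl
    complete zero (suc i) r = f-complete j₀ i (R.trans (R.sym R0j₀) r)
    complete (suc i) zero r = f-complete i j₀ (R.trans r R0j₀)
    complete (suc i) (suc j) r = f-complete i j r
    f-onto′ : ∀ j → ∃ λ v → f′ v ≡ j
    f-onto′ j = suc (proj₁ (f-onto j)) , proj₂ (f-onto j)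
... | k , f , f-sound , f-complete , f-onto | no ¬R0 = suc k , f′ , sound , complete , f-onto′
  where
    module R = IsDecEquivalence R-equiv
    f′ : Fin (suc n) → Fin (suc k)
    f′ zero = zero
    f′ (suc i) = suc (f i)
    sound : ∀ u v → f′ u ≡ f′ v → R u v
    sound zero zero _ = R.refl
    sound (suc i) (suc j) e = f-sound i j (suc-injective e)
    complete : ∀ u v → R u v → f′ u ≡ f′ v
    complete zero zero _ = refl
    complete zero (suc i) r = ⊥-elim (¬R0 (i , r))
    complete (suc i) zero r = ⊥-elim (¬R0 (i , R.sym r))
    complete (suc i) (suc j) r = cong suc (f-complete i j r)
    f-onto′ : ∀ j → ∃ λ v → f′ v ≡ j
    f-onto′ zero = zero , refl
    f-onto′ (suc j) = suc (proj₁ (f-onto j)) , cong suc (proj₂ (f-onto j))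

Labelling-resp : ∀ {n} {R S : Fin n → Fin n → Set} {k} → (∀ {u v} → R u v → S u v) → (∀ {u v} → S u v → R u v) →
  Labelling R k → Labelling S k
Labelling-resp R⊆S S⊆R (f , f-sound , f-complete , f-onto) =
  f , (λ u v e → R⊆S (f-sound u v e)) , (λ u v Suv → f-complete u v (S⊆R Suv)) , f-onto

injective⇒surjective : ∀ {k} (f : Fin k → Fin k) → (∀ {i j} → f i ≡ f j → i ≡ j) → ∀ j → ∃ λ i → f i ≡ j
injective⇒surjective {suc k} f f-inj j with any? (λ i → f i ≟ j)
... | yes hit = hit
... | no miss = ⊥-elim (ℕ.n≮n k (injective⇒≤ f′-inj))
  where
    f′ : Fin (suc k) → Fin k
    f′ i = punchOut {i = j} {j = f i} (miss ∘ (i ,_) ∘ sym)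
    f′-inj : ∀ {i i′} → f′ i ≡ f′ i′ → i ≡ i′
    f′-inj {i} {i′} e = f-inj (punchOut-injective (miss ∘ (i ,_) ∘ sym) (miss ∘ (i′ ,_) ∘ sym) e)

surjective⇒injective : ∀ {k} (g : Fin k → Fin k) → (∀ j → ∃ λ i → g i ≡ j) → ∀ {i j} → g i ≡ g j → i ≡ j
surjective⇒injective {k} g g-onto {i} {j} gi≡gj
  with injective⇒surjective section section-inj i | injective⇒surjective section section-inj j
  where
    section : Fin k → Fin k
    section j = proj₁ (g-onto j)
    section-inj : ∀ {i j} → section i ≡ section j → i ≡ j
    section-inj {i} {j} e = trans (sym (proj₂ (g-onto i))) (trans (cong g e) (proj₂ (g-onto j)))
... | a , refl | b , refl = cong (proj₁ ∘ g-onto) (trans (sym (proj₂ (g-onto a))) (trans gi≡gj (proj₂ (g-onto b))))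

Labelling-size≤ : ∀ {n} {R : Fin n → Fin n → Set} {k} → Labelling R k → k ℕ.≤ n
Labelling-size≤ (f , _ , _ , f-onto) =
  injective⇒≤ (λ {i} {j} e → trans (sym (proj₂ (f-onto i))) (trans (cong f e) (proj₂ (f-onto j))))

Labelling-⊆ : ∀ {n} {R S : Fin n → Fin n → Set} {k} → (∀ {u v} → R u v → S u v) →
  Labelling R k → Labelling S k → ∀ {u v} → S u v → R u v
Labelling-⊆ {k = k} R⊆S (f , f-sound , f-complete , f-onto) (h , h-sound , h-complete , h-onto) {u} {v} Suv =
  f-sound u v (surjective⇒injective g g-onto (trans (sym (h≡g∘f u)) (trans (h-complete u v Suv) (h≡g∘f v))))
  where
    rep : Fin k → Fin _
    rep j = proj₁ (f-onto j)
    g : Fin k → Fin k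
    g j = h (rep j)
    h≡g∘f : ∀ w → h w ≡ g (f w)
    h≡g∘f w = h-complete w (rep (f w)) (R⊆S (f-sound w (rep (f w)) (sym (proj₂ (f-onto (f w))))))
    g-onto : ∀ j → ∃ λ i → g i ≡ j
    g-onto j = f (proj₁ (h-onto j)) , trans (sym (h≡g∘f (proj₁ (h-onto j)))) (proj₂ (h-onto j))

Connected-sym : ∀ {n} {q : Quiver n} {u v} → Connected q u v → Connected q v u
Connected-sym = Star.reverse λ { (inj₁ e) → inj₂ e ; (inj₂ e) → inj₁ e }

Connected-mono : ∀ {n} {q q′ : Quiver n} → (∀ v w → q v w ≡ true → q′ v w ≡ true) →
  ∀ {u v} → Connected q u v → Connected q′ u v
Connected-mono q⊆q′ = Star.map λ { (inj₁ e) → inj₁ (q⊆q′ _ _ e) ; (inj₂ e) → inj₂ (q⊆q′ _ _ e) }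

connected? : ∀ {n} (q : Quiver n) u v → Dec (Connected q u v)
connected? q = star? (λ u v → (q u v Bool.≟ true) ⊎-dec (q v u Bool.≟ true))

Connected-isDecEquivalence : ∀ {n} (q : Quiver n) → IsDecEquivalence (Connected q)
Connected-isDecEquivalence q = record
  { isEquivalence = record { refl = Star.ε ; sym = Connected-sym ; trans = _◅◅_ }
  ; _≟_ = connected? q }

components : ∀ {n} (q : Quiver n) → ∃ (NumComponents q)
components q = labelling (Connected-isDecEquivalence q)

component-indicator : ∀ {n} → Quiver n → Fin n → Point n
component-indicator q v x = if does (connected? q v x) then 1ℚ else 0ℚ

component-indicator-∈ : ∀ {n} {q : Quiver n} {v x} → Connected q v x → component-indicator q v x ≡ 1ℚ
component-indicator-∈ {q = q} {v} {x} v~x = cong (λ b → if b then 1ℚ else 0ℚ) (dec-true (connected? q v x) v~x)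

component-indicator-∉ : ∀ {n} {q : Quiver n} {v x} → ¬ Connected q v x → component-indicator q v x ≡ 0ℚ
component-indicator-∉ {q = q} {v} {x} v≁x = cong (λ b → if b then 1ℚ else 0ℚ) (dec-false (connected? q v x) v≁x)

component-indicator-DE : ∀ {n} {q : Quiver n} {v} {x : Point n} → DE q x → component-indicator q v · x ≡ 0ℚ
component-indicator-DE {q = q} {v} = DE-level (component-indicator q v) 0ℚ level
  where
    level : ∀ x y → q x y ≡ true → component-indicator q v x - component-indicator q v y ≡ 0ℚ
    level x y qxy with connected? q v x
    ... | yes v~x = cong₂ _-_ (component-indicator-∈ v~x) (component-indicator-∈ (v~x ◅◅ (inj₁ qxy ◅ Star.ε)))
    ... | no v≁x = cong₂ _-_ (component-indicator-∉ v≁x) (component-indicator-∉ (v≁x ∘ (_◅◅ (inj₂ qxy ◅ Star.ε))))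

HasC-Connected-⊇ : ∀ {n} {r q : Quiver n} {c} → (∀ v w → r v w ≡ true → q v w ≡ true) →
  HasC r c → HasC q c → ∀ {u v} → Connected q u v → Connected r u v
HasC-Connected-⊇ r⊆q (kr , r-comps , c≡) (kq , q-comps , c≡′)
  with ℕ.∸-cancelˡ-≡ (Labelling-size≤ r-comps) (Labelling-size≤ q-comps) (trans (sym c≡) c≡′)
... | refl = Labelling-⊆ (Connected-mono r⊆q) r-comps q-comps

-- Integrality of rank differences

-- Integers are handled as differences fromℕ a - fromℕ b.
fromℕ : ℕ → ℚ
fromℕ zero = 0ℚ
fromℕ (suc k) = 1ℚ + fromℕ k

fromℕ-nonNeg : ∀ k → 0ℚ ≤ fromℕ k
fromℕ-nonNeg zero = ≤-refl
fromℕ-nonNeg (suc k) = +-mono-≤ 0≤1 (fromℕ-nonNeg k)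

fromℕ-mono-≤ : ∀ {a b} → a ℕ.≤ b → fromℕ a ≤ fromℕ b
fromℕ-mono-≤ {b = b} ℕ.z≤n = fromℕ-nonNeg b
fromℕ-mono-≤ (ℕ.s≤s a≤b) = +-monoʳ-≤ 1ℚ (fromℕ-mono-≤ a≤b)

fromℕ-gap : ∀ {a b} → a ℕ.< b → 1ℚ ≤ fromℕ b - fromℕ a
fromℕ-gap {a} {b} a<b = subst (_≤ fromℕ b - fromℕ a)
  (solve 1 (λ x → con 1ℚ :+ x :- x := con 1ℚ) refl (fromℕ a))
  (+-monoˡ-≤ (- fromℕ a) (fromℕ-mono-≤ a<b))

1≤t⇒unit-product-nonPos : ∀ {t} → 1ℚ ≤ t → (1ℚ - t) * (1ℚ + t) ≤ 0ℚ
1≤t⇒unit-product-nonPos {t} 1≤t = subst (_≤ 0ℚ) (*-comm (1ℚ + t) (1ℚ - t))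
  (nonPositive⁻¹ _ {{nonNeg*nonPos⇒nonPos (1ℚ + t) {{nonNegative 0≤1+t}} (1ℚ - t) {{nonPositive 1-t≤0}}}})
  where
    0≤1+t : 0ℚ ≤ 1ℚ + t
    0≤1+t = +-mono-≤ 0≤1 (≤-trans 0≤1 1≤t)
    1-t≤0 : 1ℚ - t ≤ 0ℚ
    1-t≤0 = subst (1ℚ - t ≤_) (+-inverseʳ t) (+-monoˡ-≤ (- t) 1≤t)

integral-unit-interval : ∀ a b → 0ℚ < (1ℚ - (fromℕ a - fromℕ b)) * (1ℚ + (fromℕ a - fromℕ b)) →
  fromℕ a - fromℕ b ≡ 0ℚ
integral-unit-interval a b 0<product with ℕ.<-cmp a b
... | tri< a<b _ _ = ⊥-elim (<-irrefl refl (<-≤-trans 0<product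
      (subst (_≤ 0ℚ) swap-sign (1≤t⇒unit-product-nonPos (fromℕ-gap a<b)))))
  where
    swap-sign : (1ℚ - (fromℕ b - fromℕ a)) * (1ℚ + (fromℕ b - fromℕ a)) ≡
                (1ℚ - (fromℕ a - fromℕ b)) * (1ℚ + (fromℕ a - fromℕ b))
    swap-sign = solve 2 (λ x y → (con 1ℚ :- (y :- x)) :* (con 1ℚ :+ (y :- x)) :=
                                 (con 1ℚ :- (x :- y)) :* (con 1ℚ :+ (x :- y))) refl (fromℕ a) (fromℕ b)
... | tri≈ _ refl _ = +-inverseʳ (fromℕ a)
... | tri> _ _ b<a = ⊥-elim (<-irrefl refl (<-≤-trans 0<product (1≤t⇒unit-product-nonPos (fromℕ-gap b<a))))

rank-forward : ∀ {n} {r : Quiver n} {ρ : Fin n → ℚ} → IsRankFunction r ρ →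
  ∀ {v w} → r v w ≡ true → ρ w - ρ v ≡ 1ℚ
rank-forward {ρ = ρ} rank {v} {w} rvw = trans (cong (_- ρ v) (sym (rank v w rvw)))
  (solve 1 (λ x → x :+ con 1ℚ :- x := con 1ℚ) refl (ρ v))

rank-backward : ∀ {n} {r : Quiver n} {ρ : Fin n → ℚ} → IsRankFunction r ρ →
  ∀ {v w} → r w v ≡ true → ρ w - ρ v ≡ - 1ℚ
rank-backward {ρ = ρ} rank {v} {w} rwv = trans (solve 2 (λ x y → y :- x := :- (x :- y)) refl (ρ v) (ρ w))
  (cong -_ (rank-forward rank rwv))

rank-difference-integral : ∀ {n} {r : Quiver n} {ρ : Fin n → ℚ} → IsRankFunction r ρ →
  ∀ {v w} → Connected r v w → ∃₂ λ a b → ρ w - ρ v ≡ fromℕ a - fromℕ b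
rank-difference-integral {ρ = ρ} rank {v} Star.ε = 0 , 0 , trans (+-inverseʳ (ρ v)) (sym (+-inverseʳ 0ℚ))
rank-difference-integral {ρ = ρ} rank {v} {w} (_◅_ {j = y} step p)
  with a , b , eq ← rank-difference-integral rank p | step
... | inj₁ rvy = suc a , b , (begin
  ρ w - ρ v                    ≡⟨ telescope (ρ v) (ρ y) (ρ w) ⟩
  (ρ w - ρ y) + (ρ y - ρ v)    ≡⟨ cong₂ _+_ eq (rank-forward rank rvy) ⟩
  fromℕ a - fromℕ b + 1ℚ       ≡⟨ solve 2 (λ x z → x :- z :+ con 1ℚ := con 1ℚ :+ x :- z) refl (fromℕ a) (fromℕ b) ⟩
  fromℕ (suc a) - fromℕ b      ∎)
  where open ≡-Reasoning
... | inj₂ ryv = a , suc b , (begin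
  ρ w - ρ v                    ≡⟨ telescope (ρ v) (ρ y) (ρ w) ⟩
  (ρ w - ρ y) + (ρ y - ρ v)    ≡⟨ cong₂ _+_ eq (rank-backward rank ryv) ⟩
  fromℕ a - fromℕ b + - 1ℚ     ≡⟨ solve 2 (λ x z → x :- z :+ :- con 1ℚ := x :- (con 1ℚ :+ z)) refl (fromℕ a) (fromℕ b) ⟩
  fromℕ a - fromℕ (suc b)      ∎)
  where open ≡-Reasoning

module _ {n} (G : SimpleGraph n) (r : Quiver n) (r⊆D : IsLlufSubquiver r (double G)) where

  private
    D : Quiver n
    D = double G

    D-sym : ∀ {v w} → D v w ≡ true → D w v ≡ true
    D-sym {v} {w} Dvw = trans (SimpleGraph.sym G w v) Dvw

    D-irrefl : ∀ {v w} → D v w ≡ true → v ≢ w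
    D-irrefl {v} Dvv refl = contradiction (trans (sym Dvv) (SimpleGraph.irrefl G v)) λ ()

  cond3⇒cond2 : Cond3 G r → Cond2 G r
  cond3⇒cond2 (same-c , ρ , slope) = same-c , (λ v → - ρ v) , rank , λ v w v′ w′ Dvw rvw≢ Dv′w′ rv′w′≢ →
    *-pos (slack-pos Dvw rvw≢) (slack-pos Dv′w′ rv′w′≢)
    where
      rank : IsRankFunction r (λ v → - ρ v)
      rank v w rvw = trans (cong (- ρ v +_) (sym (proj₁ (slope v w (r⊆D v w rvw)) rvw)))
        (solve 2 (λ x y → :- x :+ (x :- y) := :- y) refl (ρ v) (ρ w))
      slope≤0 : ∀ {v w} → D v w ≡ true → r v w ≡ false → ρ v - ρ w ≤ 0ℚ
      slope≤0 {v} {w} Dvw rvw≢ with r w v in rwv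
      ... | true = subst (_≤ 0ℚ) (sym (proj₁ (proj₂ (slope v w Dvw)) rwv)) (toWitness {a? = - 1ℚ ≤? 0ℚ} _)
      ... | false = ≤-reflexive (proj₂ (proj₂ (slope v w Dvw)) rvw≢ rwv)
      slack-pos : ∀ {v w} → D v w ≡ true → r v w ≡ false → 0ℚ < - ρ v - - ρ w + 1ℚ
      slack-pos {v} {w} Dvw rvw≢ = subst (0ℚ <_)
        (solve 2 (λ x y → con 1ℚ :- (x :- y) := :- x :- :- y :+ con 1ℚ) refl (ρ v) (ρ w))
        (<-≤-trans (toWitness {a? = 0ℚ <? 1ℚ} _) (subst (_≤ 1ℚ - (ρ v - ρ w)) (+-identityʳ 1ℚ)
          (+-monoʳ-≤ 1ℚ (neg-antimono-≤ (slope≤0 Dvw rvw≢)))))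

  cond2⇒cond3 : Cond2 G r → Cond3 G r
  cond2⇒cond3 (same-c@(c , c-r , c-D) , ρ , rank , product-pos) = same-c , (λ v → - ρ v) , slope
    where
      slope : ∀ v w → D v w ≡ true →
        (r v w ≡ true → - ρ v - - ρ w ≡ 1ℚ) ×
        (r w v ≡ true → - ρ v - - ρ w ≡ - 1ℚ) ×
        (r v w ≡ false → r w v ≡ false → - ρ v - - ρ w ≡ 0ℚ)
      slope v w Dvw = forward , backward , neither
        where
          flip : - ρ v - - ρ w ≡ ρ w - ρ v
          flip = solve 2 (λ x y → :- x :- :- y := y :- x) refl (ρ v) (ρ w)
          forward : r v w ≡ true → - ρ v - - ρ w ≡ 1ℚ
          forward rvw = trans flip (rank-forward rank rvw)
          backward : r w v ≡ true → - ρ v - - ρ w ≡ - 1ℚ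
          backward rwv = trans flip (rank-backward rank rwv)
          -- The product condition for the arrows (v,w) and (w,v) puts ρ w - ρ v strictly between -1 and 1,
          -- and v, w lie in one component of R, where rank differences are integers.
          neither : r v w ≡ false → r w v ≡ false → - ρ v - - ρ w ≡ 0ℚ
          neither rvw≢ rwv≢
            with a , b , eq ← rank-difference-integral rank (HasC-Connected-⊇ r⊆D c-r c-D (inj₁ Dvw ◅ Star.ε)) =
            trans flip (trans eq (integral-unit-interval a b (subst (0ℚ <_) in-terms-of-difference
              (product-pos v w w v Dvw rvw≢ (D-sym Dvw) rwv≢))))
            where
              in-terms-of-difference : (ρ v - ρ w + 1ℚ) * (ρ w - ρ v + 1ℚ) ≡
                (1ℚ - (fromℕ a - fromℕ b)) * (1ℚ + (fromℕ a - fromℕ b))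
              in-terms-of-difference = trans
                (solve 2 (λ x y → (x :- y :+ con 1ℚ) :* (y :- x :+ con 1ℚ) :=
                                  (con 1ℚ :- (y :- x)) :* (con 1ℚ :+ (y :- x))) refl (ρ v) (ρ w))
                (cong (λ t → (1ℚ - t) * (1ℚ + t)) eq)

  cond3⇒face : Cond3 G r → IsFace (DE r) (SE G)
  cond3⇒face (_ , ρ , slope) =
    ρ , 1ℚ , (λ x → DE-bound ρ 1ℚ slope≤1) ,
    (λ x x∈ → DE-mono r⊆D x∈ , DE-level ρ 1ℚ (λ v w rvw → proj₁ (slope v w (r⊆D v w rvw)) rvw) x∈) ,
    (λ x → DE-tight ρ 1ℚ slope≤1 slope≡1⇒r)
    where
      slope≤1 : ∀ v w → D v w ≡ true → ρ v - ρ w ≤ 1ℚ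
      slope≤1 v w Dvw with r v w in rvw | r w v in rwv
      ... | true | _ = ≤-reflexive (proj₁ (slope v w Dvw) rvw)
      ... | false | true = subst (_≤ 1ℚ) (sym (proj₁ (proj₂ (slope v w Dvw)) rwv)) (toWitness {a? = - 1ℚ ≤? 1ℚ} _)
      ... | false | false = subst (_≤ 1ℚ) (sym (proj₂ (proj₂ (slope v w Dvw)) rvw rwv)) 0≤1
      slope≡1⇒r : ∀ v w → D v w ≡ true → ρ v - ρ w ≡ 1ℚ → r v w ≡ true
      slope≡1⇒r v w Dvw slope≡1 with r v w in rvw | r w v in rwv
      ... | true | _ = refl
      ... | false | true = contradiction (trans (sym (proj₁ (proj₂ (slope v w Dvw)) rwv)) slope≡1) λ ()
      ... | false | false = contradiction (trans (sym (proj₂ (proj₂ (slope v w Dvw)) rvw rwv)) slope≡1) λ ()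

  module _ (a : Point n) (b : ℚ)
    (valid : ∀ x → SE G x → a · x ≤ b)
    (on-face : ∀ x → DE r x → SE G x × a · x ≡ b)
    (tight : ∀ x → SE G x → a · x ≡ b → DE r x)
    {d : ℕ} (dim-r : AffDim (DE r) d) (dim-D : AffDim (SE G) (suc d)) where

    private
      slope≤b : ∀ {v w} → D v w ≡ true → a v - a w ≤ b
      slope≤b {v} {w} Dvw = subst (_≤ b) (·-ε a v w) (valid _ (ε∈DE Dvw))

      r⇒slope≡b : ∀ {v w} → r v w ≡ true → a v - a w ≡ b
      r⇒slope≡b {v} {w} rvw = trans (sym (·-ε a v w)) (proj₂ (on-face _ (ε∈DE rvw)))

      slope≡b⇒r : ∀ {v w} → D v w ≡ true → a v - a w ≡ b → r v w ≡ true
      slope≡b⇒r {v} {w} Dvw slope≡b with r v w in rvw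
      ... | true = refl
      ... | false = ⊥-elim (ε∉DE (D-irrefl Dvw) rvw (tight _ (ε∈DE Dvw) (trans (·-ε a v w) slope≡b)))

      slope<b : ∀ {v w} → D v w ≡ true → r v w ≡ false → a v - a w < b
      slope<b {v} {w} Dvw rvw≢ with <-cmp (a v - a w) b
      ... | tri< s<b _ _ = s<b
      ... | tri≈ _ s≡b _ = contradiction (trans (sym (slope≡b⇒r Dvw s≡b)) rvw≢) λ ()
      ... | tri> _ _ s>b = ⊥-elim (<-irrefl refl (<-≤-trans s>b (slope≤b Dvw)))

      -- If b ≤ 0, both a v - a w ≤ b and a w - a v ≤ b force every arrow of D(G) to be tight,
      -- so SE(G) ⊆ DE(R), contradicting the dimension gap.
      0<b : 0ℚ < b
      0<b = ≰⇒> λ b≤0 → AffDim-⊆ (λ x → DE-mono {x = x} (λ v w Dvw →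
        slope≡b⇒r Dvw (≤-antisym (slope≤b Dvw) (b≤slope b≤0 Dvw)))) dim-r dim-D
        where
          b≤slope : b ≤ 0ℚ → ∀ {v w} → D v w ≡ true → b ≤ a v - a w
          b≤slope b≤0 {v} {w} Dvw = ≤-trans (≤-trans b≤0 (neg-antimono-≤ b≤0))
            (subst (- b ≤_) (solve 2 (λ x y → :- (y :- x) := x :- y) refl (a v) (a w))
              (neg-antimono-≤ (slope≤b (D-sym Dvw))))

      instance
        b≢0 : NonZero b
        b≢0 = pos⇒nonZero b {{positive 0<b}}

      ρ : Fin n → ℚ
      ρ v = - (a v * 1/ b)

      ρ-rank : IsRankFunction r ρ
      ρ-rank v w rvw = begin
        - (a v * 1/ b) + 1ℚ                  ≡⟨ cong (- (a v * 1/ b) +_) (sym (*-inverseʳ b)) ⟩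
        - (a v * 1/ b) + b * 1/ b            ≡⟨ cong (λ z → - (a v * 1/ b) + z * 1/ b) (sym (r⇒slope≡b rvw)) ⟩
        - (a v * 1/ b) + (a v - a w) * 1/ b  ≡⟨ solve 3 (λ x y i → :- (x :* i) :+ (x :- y) :* i := :- (y :* i)) refl (a v) (a w) (1/ b) ⟩
        - (a w * 1/ b)                       ∎
        where open ≡-Reasoning

      ρ-slack-pos : ∀ {v w} → D v w ≡ true → r v w ≡ false → 0ℚ < ρ v - ρ w + 1ℚ
      ρ-slack-pos {v} {w} Dvw rvw≢ = subst (0ℚ <_) slack≡
        (*-pos (<⇒0<- (slope<b Dvw rvw≢)) (positive⁻¹ (1/ b) {{1/pos⇒pos b {{positive 0<b}}}}))
        where
          slack≡ : (b - (a v - a w)) * 1/ b ≡ ρ v - ρ w + 1ℚ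
          slack≡ = trans
            (solve 4 (λ c x y i → (c :- (x :- y)) :* i := :- (x :* i) :- :- (y :* i) :+ c :* i) refl b (a v) (a w) (1/ b))
            (cong (ρ v - ρ w +_) (*-inverseʳ b))

      -- Otherwise the indicator h of the component of v in R vanishes on DE(R) but not at ε v w, while
      -- a · _ ≡ b ≢ 0 on DE(R); so ε v w, the origin and d + 1 independent points of DE(R) would be
      -- d + 3 affinely independent points of SE(G).
      edge⇒connected : ∀ {v w} → D v w ≡ true → Connected r v w
      edge⇒connected {v} {w} Dvw with connected? r v w
      ... | yes v~w = v~w
      ... | no v≁w = ⊥-elim (proj₂ dim-D (ε v w ∷ ((λ _ → 0ℚ) ∷ p)) in-SE independent)
        where
          p : Fin (suc d) → Point n
          p = proj₁ (proj₁ dim-r)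
          p∈DE : ∀ j → DE r (p j)
          p∈DE = proj₁ (proj₂ (proj₁ dim-r))
          in-SE : ∀ j → SE G ((ε v w ∷ ((λ _ → 0ℚ) ∷ p)) j)
          in-SE zero = ε∈DE Dvw
          in-SE (suc zero) = origin∈DE Dvw (D-sym Dvw)
          in-SE (suc (suc j)) = DE-mono r⊆D (p∈DE j)
          h : Point n
          h = component-indicator r v
          h·origin∷p≡0 : ∀ j → h · ((λ _ → 0ℚ) ∷ p) j ≡ 0ℚ
          h·origin∷p≡0 zero = ·-zeroʳ h
          h·origin∷p≡0 (suc j) = component-indicator-DE (p∈DE j)
          h·ε≢0 : h · ε v w ≢ 0ℚ
          h·ε≢0 eq = contradiction (begin
            1ℚ - 0ℚ    ≡⟨ sym (cong₂ _-_ (component-indicator-∈ {q = r} Star.ε) (component-indicator-∉ v≁w)) ⟩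
            h v - h w  ≡⟨ sym (·-ε h v w) ⟩
            h · ε v w  ≡⟨ eq ⟩
            0ℚ         ∎) λ ()
            where open ≡-Reasoning
          independent : AffinelyIndependent (ε v w ∷ ((λ _ → 0ℚ) ∷ p))
          independent = AffinelyIndependent-∷ h h·origin∷p≡0 h·ε≢0
            (AffinelyIndependent-origin∷ a b (λ j → proj₂ (on-face _ (p∈DE j))) (<⇒≢ 0<b ∘ sym)
              (proj₂ (proj₂ (proj₁ dim-r))))

    face⇒cond2 : Cond2 G r
    face⇒cond2 = (n ∸ k , (k , r-comps , refl) , (k , D-comps , refl)) , ρ , ρ-rank ,
      λ v w v′ w′ Dvw rvw≢ Dv′w′ rv′w′≢ → *-pos (ρ-slack-pos Dvw rvw≢) (ρ-slack-pos Dv′w′ rv′w′≢)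
      where
        k : ℕ
        k = proj₁ (components r)
        r-comps : NumComponents r k
        r-comps = proj₂ (components r)
        D⊆r : ∀ {u v} → Connected D u v → Connected r u v
        D⊆r = Star.concat ∘ Star.map λ
          { (inj₁ Dxy) → edge⇒connected Dxy
          ; (inj₂ Dyx) → Connected-sym (edge⇒connected Dyx) }
        D-comps : NumComponents D k
        D-comps = Labelling-resp (Connected-mono r⊆D) D⊆r r-comps

  cond1⇒cond2 : Cond1 G r → Cond2 G r
  cond1⇒cond2 ((a , b , valid , on-face , tight) , _ , dim-r , dim-D) = face⇒cond2 a b valid on-face tight dim-r dim-D

corollary5p4 : ∀ {n} (G : SimpleGraph n) (r : Quiver n) →
    IsLlufSubquiver r (double G) →
    (∃ λ d → AffDim (DE r) d × AffDim (SE G) (suc d)) →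
    (Cond1 G r ⇔ Cond2 G r) × (Cond2 G r ⇔ Cond3 G r)
corollary5p4 G r r⊆D dims =
  mk⇔ (cond1⇒cond2 G r r⊆D) (λ c2 → cond3⇒face G r r⊆D (cond2⇒cond3 G r r⊆D c2) , dims) ,
  mk⇔ (cond2⇒cond3 G r r⊆D) (cond3⇒cond2 G r r⊆D)
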